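{- Let $n \geq 1$ and let $G = \bigcup_{i=1}^{n} A_i$ be a graph which is the union of $n$ complete graphs $A_1, A_2, \dots, A_n$, each having exactly $n$ vertices, such that every pair of distinct complete graphs $A_i, A_j$ has at most one common vertex. Suppose that every $A_i$ ($1 \leq i \leq n$) contains at most $\sqrt{n}$ vertices of clique degree greater than $1$. Then $G$ is $n$-colorable, i.e. there is a proper vertex coloring of $G$ using $n$ colors.
   Context: For a vertex $v$ of $G$, the clique degree is $d^K(v) = |\{A_i : v \in V(A_i),\ 1 \leq i \leq n\}|$, the number of the complete graphs $A_i$ containing $v$. -}

module Defs where

open import Data.Nat using (ℕ; _<_; _≤_; _*_)
open import Data.Fin using (Fin)
open import Data.Fin.Properties using (any?)
open import Data.List using (List; length; filter; allFin)
open import Data.Product using (∃; _,_)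
open import Relation.Binary.Definitions using (DecidableEquality)
open import Relation.Binary.PropositionalEquality using (_≡_; _≢_)
open import Relation.Nullary using (Dec)
open import Data.Nat.Properties using (_<?_)

-- A family of n cliques A_1..A_n, each with exactly n vertices:
-- clique i is given by an injective enumeration  A i : Fin n → V.
CliqueFamily : Set → ℕ → Set
CliqueFamily V n = Fin n → Fin n → V

_∈ᶜ_ : {V : Set} {n : ℕ} → V → (Fin n → V) → Set
v ∈ᶜ a = ∃ λ k → a k ≡ v

∈ᶜ? : {V : Set} {n : ℕ} → DecidableEquality V → (v : V) (a : Fin n → V) → Dec (v ∈ᶜ a)
∈ᶜ? _≟_ v a = any? (λ k → a k ≟ v)

EachHasNVertices : {V : Set} {n : ℕ} → CliqueFamily V n → Set
EachHasNVertices {n = n} A = (i k l : Fin n) → A i k ≡ A i l → k ≡ l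

AtMostOneCommon : {V : Set} {n : ℕ} → CliqueFamily V n → Set
AtMostOneCommon {V} {n} A =
  (i j : Fin n) → i ≢ j → (u w : V) →
  u ∈ᶜ A i → u ∈ᶜ A j → w ∈ᶜ A i → w ∈ᶜ A j → u ≡ w

cliqueDegree : {V : Set} {n : ℕ} → DecidableEquality V → CliqueFamily V n → V → ℕ
cliqueDegree {n = n} _≟_ A v = length (filter (λ i → ∈ᶜ? _≟_ v (A i)) (allFin n))

sharedCount : {V : Set} {n : ℕ} → DecidableEquality V → CliqueFamily V n → Fin n → ℕ
sharedCount {n = n} _≟_ A i =
  length (filter (λ k → 1 <? cliqueDegree _≟_ A (A i k)) (allFin n))

-- Colours are assigned to all of V; elements of V not in any A_i are
-- not vertices of G and are unconstrained.
ProperColouring : {V : Set} {n : ℕ} → CliqueFamily V n → (V → Fin n) → Set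
ProperColouring {V} {n} A c =
  (i : Fin n) (u w : V) → u ∈ᶜ A i → w ∈ᶜ A i → u ≢ w → c u ≢ c w

-- Colour the vertices greedily along an order of increasing clique degree d,
-- each vertex avoiding the colours of its neighbours later in the order; it
-- suffices that every vertex v has fewer than n later neighbours R.  Count,
-- with multiplicity, vertex slots of suitable cliques, in which v fills d(v)
-- slots and each u ∈ R at least one, respectively at least d(u) ≥ d(v).  Let
-- t ≤ √n be the largest number of shared vertices (d > 1) of a clique.  If
-- d(v) ≤ 1, use the n slots of the clique of v; if 1 < d(v) ≤ t, the at most
-- d(v)·t ≤ n shared slots of the cliques through v; otherwise the at most
-- n·t < n·d(v) shared slots of all cliques.

module Submission where

open import Defs
open import Data.Nat using (ℕ; zero; suc; _+_; _*_; _≤_; _<_; s≤s; z≤n; _<?_; _≤?_; >-nonZero)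
open import Data.Nat.Properties
open import Data.Nat.ListAction using (sum)
open import Data.List.Extrema ≤-totalOrder using (max; xs≤max; argmax-all)
open import Data.Fin using (Fin; zero)
open import Data.Fin.Properties using (any?; ¬∀⟶∃¬; pigeonhole) renaming (_≟_ to _≟ᶠ_; <-irrefl to <ᶠ-irrefl)
open import Data.List using (List; []; _∷_; _++_; length; map; concatMap; filter; allFin; lookup; tabulate; deduplicate)
open import Data.List.Properties using (length-map; length-++; length-tabulate; filter-all; filter-idem)
open import Data.List.Relation.Unary.All as All using (All; []; _∷_)
import Data.List.Relation.Unary.All.Properties as Allₚ
open import Data.List.Relation.Unary.Any as Any using (here; there)
open import Data.List.Relation.Unary.Any.Properties using (lookup-index)
open import Data.List.Relation.Unary.AllPairs using (AllPairs; []; _∷_)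
import Data.List.Relation.Unary.AllPairs.Properties as AllPairsₚ
open import Data.List.Relation.Unary.Unique.Propositional using (Unique)
open import Data.List.Relation.Unary.Unique.DecPropositional.Properties using (deduplicate-!)
open import Data.List.Relation.Binary.Permutation.Propositional using (↭-sym; ↭⇒↭ₛ)
open import Data.List.Relation.Binary.Permutation.Propositional.Properties using (∈-resp-↭)
open import Data.List.Relation.Binary.Permutation.Setoid.Properties using (Unique-resp-↭)
open import Data.List.Relation.Unary.Sorted.TotalOrder.Properties using (Sorted⇒AllPairs)
open import Data.List.Membership.Propositional using (_∈_; _∉_; lose)
open import Data.List.Membership.Propositional.Properties
  using (∈-allFin; ∈-filter⁺; ∈-filter⁻; ∈-map⁺; ∈-tabulate⁺; ∈-deduplicate⁺; ∈-concatMap⁺)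
import Data.List.Membership.DecPropositional as DecMembership
open import Data.Product using (∃; _,_; _×_; proj₂)
open import Data.Empty using (⊥-elim)
open import Data.Unit using (tt)
open import Relation.Nullary using (Dec; yes; no; ¬_)
open import Relation.Nullary.Decidable using (_×-dec_; ¬?)
open import Relation.Unary using (Decidable)
open import Relation.Unary.Properties using (U?)
open import Relation.Binary.Bundles using (DecTotalOrder)
open import Relation.Binary.Definitions using (DecidableEquality)
import Relation.Binary.Construct.On as On
open import Relation.Binary.PropositionalEquality
open import Function using (_∘_; id)

length<⇒∃∉ : ∀ {n} (cs : List (Fin n)) → length cs < n → ∃ λ c → c ∉ cs
length<⇒∃∉ {n} cs short = ¬∀⟶∃¬ n (_∈ cs) (_∈? cs) all∈
  where
  open DecMembership _≟ᶠ_ using (_∈?_)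
  all∈ : ¬ (∀ c → c ∈ cs)
  all∈ c∈ with pigeonhole short (λ c → Any.index (c∈ c))
  ... | i , j , i<j , same-index = <ᶠ-irrefl i≡j i<j
    where
    i≡j : i ≡ j
    i≡j = trans (lookup-index (c∈ i)) (trans (cong (lookup cs) same-index) (sym (lookup-index (c∈ j))))

firstFree : ∀ {k} → List (Fin (suc k)) → Fin (suc k)
firstFree cs with any? (λ c → ¬? (c ∈? cs))
  where open DecMembership _≟ᶠ_ using (_∈?_)
... | yes (c , _) = c
... | no _ = zero

firstFree-∉ : ∀ {k} (cs : List (Fin (suc k))) → length cs < suc k → firstFree cs ∉ cs
firstFree-∉ cs short with any? (λ c → ¬? (c ∈? cs))
  where open DecMembership _≟ᶠ_ using (_∈?_)
... | yes (_ , c∉cs) = c∉cs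
... | no none = ⊥-elim (none (length<⇒∃∉ cs short))

module Greedy {V : Set} (_≟_ : DecidableEquality V) {Adj : V → V → Set}
  (adj? : ∀ u w → Dec (Adj u w)) (adj-sym : ∀ {u w} → Adj u w → Adj w u) (k : ℕ) where

  greedy : List V → V → Fin (suc k)
  greedy [] _ = zero
  greedy (v ∷ rest) w with w ≟ v
  ... | yes _ = firstFree (map (greedy rest) (filter (adj? v) rest))
  ... | no _ = greedy rest w

  data Degenerate : List V → Set where
    [] : Degenerate []
    _∷_ : ∀ {v rest} → length (filter (adj? v) rest) < suc k → Degenerate rest → Degenerate (v ∷ rest)

  private
    firstFree-fresh : ∀ {v rest w} → length (filter (adj? v) rest) < suc k → w ∈ rest → Adj v w →
      firstFree (map (greedy rest) (filter (adj? v) rest)) ≢ greedy rest w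
    firstFree-fresh {v} {rest} few w∈ vw same = firstFree-∉ taken
      (subst (_< suc k) (sym (length-map (greedy rest) (filter (adj? v) rest))) few)
      (subst (_∈ taken) (sym same) (∈-map⁺ (greedy rest) (∈-filter⁺ (adj? v) w∈ vw)))
      where taken = map (greedy rest) (filter (adj? v) rest)

  greedy-proper : ∀ {L} → Degenerate L →
    ∀ {u w} → u ∈ L → w ∈ L → Adj u w → u ≢ w → greedy L u ≢ greedy L w
  greedy-proper {v ∷ rest} (few ∷ deg) {u} {w} u∈ w∈ uw u≢w with u ≟ v | w ≟ v
  ... | yes refl | yes refl = ⊥-elim (u≢w refl)
  ... | yes refl | no w≢v = firstFree-fresh few (Any.tail w≢v w∈) uw
  ... | no u≢v | yes refl = firstFree-fresh few (Any.tail u≢v u∈) (adj-sym uw) ∘ sym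
  ... | no u≢v | no w≢v = greedy-proper deg (Any.tail u≢v u∈) (Any.tail w≢v w∈) uw u≢w

module Occurrences {V : Set} (_≟_ : DecidableEquality V) where

  occurrences : V → List V → ℕ
  occurrences u [] = 0
  occurrences u (w ∷ ws) with w ≟ u
  ... | yes _ = suc (occurrences u ws)
  ... | no _ = occurrences u ws

  occurrences-++ : ∀ u xs ys → occurrences u (xs ++ ys) ≡ occurrences u xs + occurrences u ys
  occurrences-++ u [] ys = refl
  occurrences-++ u (w ∷ xs) ys with w ≟ u
  ... | yes _ = cong suc (occurrences-++ u xs ys)
  ... | no _ = occurrences-++ u xs ys

  ∈⇒1≤occurrences : ∀ {u ws} → u ∈ ws → 1 ≤ occurrences u ws
  ∈⇒1≤occurrences {u} {w ∷ ws} u∈ with w ≟ u | u∈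
  ... | yes _ | _ = s≤s z≤n
  ... | no w≢u | here u≡w = ⊥-elim (w≢u (sym u≡w))
  ... | no _ | there u∈ws = ∈⇒1≤occurrences u∈ws

  private
    total : List V → List V → ℕ
    total R ws = sum (map (λ u → occurrences u ws) R)

    total-fresh : ∀ {w} R ws → All (w ≢_) R → total R (w ∷ ws) ≡ total R ws
    total-fresh [] ws [] = refl
    total-fresh {w} (u ∷ R) ws (w≢u ∷ w∉R) with w ≟ u
    ... | yes w≡u = ⊥-elim (w≢u w≡u)
    ... | no _ = cong (occurrences u ws +_) (total-fresh R ws w∉R)

    total-∷ : ∀ {R} w ws → Unique R → total R (w ∷ ws) ≤ suc (total R ws)
    total-∷ {[]} w ws [] = z≤n
    total-∷ {u ∷ R} w ws (u∉R ∷ uniq) with w ≟ u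
    ... | yes refl = ≤-reflexive (cong (suc (occurrences u ws) +_) (total-fresh R ws u∉R))
    ... | no _ = ≤-trans (+-monoʳ-≤ (occurrences u ws) (total-∷ w ws uniq))
                         (≤-reflexive (+-suc (occurrences u ws) (total R ws)))

    total≤length : ∀ {R} → Unique R → ∀ ws → total R ws ≤ length ws
    total≤length {R} uniq [] = ≤-reflexive (zero-total R)
      where
      zero-total : ∀ R → total R [] ≡ 0
      zero-total [] = refl
      zero-total (_ ∷ R) = zero-total R
    total≤length uniq (w ∷ ws) = ≤-trans (total-∷ w ws uniq) (s≤s (total≤length uniq ws))

    length*≤total : ∀ {b} R ws → (∀ {u} → u ∈ R → b ≤ occurrences u ws) → length R * b ≤ total R ws
    length*≤total [] ws _ = z≤n
    length*≤total (u ∷ R) ws lower = +-mono-≤ (lower (here refl)) (length*≤total R ws (lower ∘ there))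

  -- Double counting: distinct vertices occupy disjoint sets of places in ws.
  occurrences-bound : ∀ {v R} ws {a b} → Unique (v ∷ R) → a ≤ occurrences v ws →
    (∀ {u} → u ∈ R → b ≤ occurrences u ws) → a + length R * b ≤ length ws
  occurrences-bound {R = R} ws uniq v-often R-often =
    ≤-trans (+-mono-≤ v-often (length*≤total R ws R-often)) (total≤length uniq ws)

module CliqueUnion {V : Set} (_≟_ : DecidableEquality V) {n : ℕ} (A : CliqueFamily V n) where

  open Occurrences _≟_

  inClique? : (u : V) (i : Fin n) → Dec (u ∈ᶜ A i)
  inClique? u i = ∈ᶜ? _≟_ u (A i)

  degree : V → ℕ
  degree = cliqueDegree _≟_ A

  cliquesOf : V → List (Fin n)
  cliquesOf u = filter (inClique? u) (allFin n)

  Adjacent : V → V → Set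
  Adjacent u w = ∃ λ i → u ∈ᶜ A i × w ∈ᶜ A i

  adjacent? : (u w : V) → Dec (Adjacent u w)
  adjacent? u w = any? (λ i → inClique? u i ×-dec inClique? w i)

  adjacent-sym : ∀ {u w} → Adjacent u w → Adjacent w u
  adjacent-sym (i , u∈ , w∈) = i , w∈ , u∈

  module _ {Q : V → Set} (Q? : Decidable Q) where

    placesIn : Fin n → List (Fin n)
    placesIn i = filter (λ k → Q? (A i k)) (allFin n)

    -- A vertex satisfying Q appears once for each clique of I containing it.
    slots : List (Fin n) → List V
    slots [] = []
    slots (i ∷ I) = map (A i) (placesIn i) ++ slots I

    length-slots≤ : ∀ {b} → (∀ i → length (placesIn i) ≤ b) → ∀ I → length (slots I) ≤ length I * b
    length-slots≤ few [] = z≤n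
    length-slots≤ {b} few (i ∷ I) = begin
      length (map (A i) (placesIn i) ++ slots I)        ≡⟨ length-++ (map (A i) (placesIn i)) ⟩
      length (map (A i) (placesIn i)) + length (slots I) ≡⟨ cong (_+ length (slots I)) (length-map (A i) (placesIn i)) ⟩
      length (placesIn i) + length (slots I)             ≤⟨ +-mono-≤ (few i) (length-slots≤ few I) ⟩
      length (i ∷ I) * b                                 ∎
      where open ≤-Reasoning

    occurrences-slots : ∀ {u} → Q u → ∀ I → length (filter (inClique? u) I) ≤ occurrences u (slots I)
    occurrences-slots q [] = z≤n
    occurrences-slots {u} q (i ∷ I) with inClique? u i
    ... | yes (k , Aik≡u) = begin
      suc (length (filter (inClique? u) I))                          ≤⟨ +-mono-≤ u-in-i (occurrences-slots q I) ⟩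
      occurrences u (map (A i) (placesIn i)) + occurrences u (slots I) ≡⟨ occurrences-++ u (map (A i) (placesIn i)) (slots I) ⟨
      occurrences u (slots (i ∷ I))                                  ∎
      where
      open ≤-Reasoning
      u-in-i : 1 ≤ occurrences u (map (A i) (placesIn i))
      u-in-i = ∈⇒1≤occurrences (subst (_∈ map (A i) (placesIn i)) Aik≡u
        (∈-map⁺ (A i) (∈-filter⁺ (λ k → Q? (A i k)) (∈-allFin k) (subst Q (sym Aik≡u) q))))
    ... | no _ = begin
      length (filter (inClique? u) I)                                ≤⟨ occurrences-slots q I ⟩
      occurrences u (slots I)                                        ≤⟨ m≤n+m _ _ ⟩
      occurrences u (map (A i) (placesIn i)) + occurrences u (slots I) ≡⟨ occurrences-++ u (map (A i) (placesIn i)) (slots I) ⟨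
      occurrences u (slots (i ∷ I))                                  ∎
      where open ≤-Reasoning

  shared? : (w : V) → Dec (1 < degree w)
  shared? w = 1 <? degree w

  maxShared : ℕ
  maxShared = max 0 (map (sharedCount _≟_ A) (allFin n))

  sharedCount≤maxShared : ∀ i → sharedCount _≟_ A i ≤ maxShared
  sharedCount≤maxShared i =
    All.lookup (xs≤max 0 (map (sharedCount _≟_ A) (allFin n))) (∈-map⁺ (sharedCount _≟_ A) (∈-allFin i))

  maxShared²≤ : ∀ {b} → (∀ i → sharedCount _≟_ A i * sharedCount _≟_ A i ≤ b) → maxShared * maxShared ≤ b
  maxShared²≤ {b} few = argmax-all id {P = λ x → x * x ≤ b} {⊥ = 0} {xs = map (sharedCount _≟_ A) (allFin n)}
    z≤n (Allₚ.map⁺ (All.tabulate (λ {i} _ → few i)))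

  private
    ∈⇒1≤length : ∀ {j} {I : List (Fin n)} → j ∈ I → 1 ≤ length I
    ∈⇒1≤length (here _) = s≤s z≤n
    ∈⇒1≤length (there _) = s≤s z≤n

  module _ {v R} (distinct : Unique (v ∷ R)) (later : ∀ {u} → u ∈ R → Adjacent v u × degree v ≤ degree u) where

    count-in-cliquesOf : ∀ {Q} (Q? : Decidable Q) {b} → Q v → (∀ {u} → u ∈ R → Q u) →
      (∀ i → length (placesIn Q? i) ≤ b) → degree v + length R ≤ degree v * b
    count-in-cliquesOf Q? {b} qv qR few = begin
      degree v + length R           ≡⟨ cong (degree v +_) (*-identityʳ (length R)) ⟨
      degree v + length R * 1       ≤⟨ occurrences-bound (slots Q? (cliquesOf v)) distinct v-often R-present ⟩
      length (slots Q? (cliquesOf v)) ≤⟨ length-slots≤ Q? few (cliquesOf v) ⟩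
      degree v * b                  ∎
      where
      open ≤-Reasoning
      v-often : degree v ≤ occurrences v (slots Q? (cliquesOf v))
      v-often = subst (_≤ occurrences v (slots Q? (cliquesOf v)))
        (cong length (filter-idem (inClique? v) (allFin n))) (occurrences-slots Q? qv (cliquesOf v))
      R-present : ∀ {u} → u ∈ R → 1 ≤ occurrences u (slots Q? (cliquesOf v))
      R-present u∈ with later u∈
      ... | (j , v∈j , u∈j) , _ = ≤-trans
        (∈⇒1≤length (∈-filter⁺ (inClique? _) (∈-filter⁺ (inClique? v) (∈-allFin j) v∈j) u∈j))
        (occurrences-slots Q? (qR u∈) (cliquesOf v))

    count-in-all-cliques : ∀ {Q} (Q? : Decidable Q) {b} → Q v → (∀ {u} → u ∈ R → Q u) →
      (∀ i → length (placesIn Q? i) ≤ b) → suc (length R) * degree v ≤ n * b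
    count-in-all-cliques Q? {b} qv qR few = begin
      suc (length R) * degree v     ≤⟨ occurrences-bound (slots Q? (allFin n)) distinct v-often R-often ⟩
      length (slots Q? (allFin n))  ≤⟨ length-slots≤ Q? few (allFin n) ⟩
      length (allFin n) * b         ≡⟨ cong (_* b) (length-tabulate {n = n} id) ⟩
      n * b                         ∎
      where
      open ≤-Reasoning
      v-often : degree v ≤ occurrences v (slots Q? (allFin n))
      v-often = occurrences-slots Q? qv (allFin n)
      R-often : ∀ {u} → u ∈ R → degree v ≤ occurrences u (slots Q? (allFin n))
      R-often u∈ = ≤-trans (proj₂ (later u∈)) (occurrences-slots Q? (qR u∈) (allFin n))

    later-shared : 1 < degree v → ∀ {u} → u ∈ R → 1 < degree u
    later-shared shared u∈ = <-≤-trans shared (proj₂ (later u∈))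

    later-neighbours< : 1 ≤ n → maxShared * maxShared ≤ n → length R < n
    later-neighbours< pos max² with degree v ≤? 1
    ... | yes d≤1 = few-cliques d≤1 (count-in-cliquesOf U? tt (λ _ → tt) (λ i → ≤-reflexive (full-row i)))
      where
      full-row : ∀ i → length (placesIn U? i) ≡ n
      full-row _ = trans (cong length (filter-all U? (All.universal _ (allFin n)))) (length-tabulate {n = n} id)
      few-cliques : ∀ {d r} → d ≤ 1 → d + r ≤ d * n → r < n
      few-cliques {zero} {zero} _ _ = pos
      few-cliques {suc zero} {r} _ h = subst (suc r ≤_) (+-identityʳ n) h
      few-cliques {suc (suc _)} (s≤s ())
    ... | no d≰1 with degree v ≤? maxShared
    ...   | yes d≤max = begin
      suc (length R)              ≤⟨ +-monoˡ-≤ (length R) (<⇒≤ (≰⇒> d≰1)) ⟩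
      degree v + length R
        ≤⟨ count-in-cliquesOf shared? (≰⇒> d≰1) (later-shared (≰⇒> d≰1)) sharedCount≤maxShared ⟩
      degree v * maxShared        ≤⟨ *-monoˡ-≤ maxShared d≤max ⟩
      maxShared * maxShared       ≤⟨ max² ⟩
      n                           ∎
      where open ≤-Reasoning
    ...   | no d≰max = *-cancelʳ-≤ (suc (length R)) n (degree v) ⦃ >-nonZero (<⇒≤ (≰⇒> d≰1)) ⦄ (begin
      suc (length R) * degree v
        ≤⟨ count-in-all-cliques shared? (≰⇒> d≰1) (later-shared (≰⇒> d≰1)) sharedCount≤maxShared ⟩
      n * maxShared               ≤⟨ *-monoʳ-≤ n (<⇒≤ (≰⇒> d≰max)) ⟩
      n * degree v                ∎)
      where open ≤-Reasoning

  vertices : List V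
  vertices = concatMap (λ i → tabulate (A i)) (allFin n)

  byDegree : DecTotalOrder _ _ _
  byDegree = On.decTotalOrder ≤-decTotalOrder degree

  open import Data.List.Sort byDegree using (sort; sort-↭; sort-↗)

  colouringOrder : List V
  colouringOrder = sort (deduplicate _≟_ vertices)

  ∈-colouringOrder : ∀ {u i} → u ∈ᶜ A i → u ∈ colouringOrder
  ∈-colouringOrder {i = i} (k , Aik≡u) = ∈-resp-↭ (↭-sym (sort-↭ _)) (∈-deduplicate⁺ _≟_
    (∈-concatMap⁺ (λ i → tabulate (A i)) (lose (∈-allFin i) (subst (_∈ tabulate (A i)) Aik≡u (∈-tabulate⁺ k)))))

  colouringOrder-unique : Unique colouringOrder
  colouringOrder-unique = Unique-resp-↭ (setoid V) (↭⇒↭ₛ (↭-sym (sort-↭ _))) (deduplicate-! _≟_ vertices)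

  colouringOrder-sorted : AllPairs (λ u w → degree u ≤ degree w) colouringOrder
  colouringOrder-sorted = Sorted⇒AllPairs (DecTotalOrder.totalOrder byDegree) (sort-↗ _)

module _ {V : Set} (_≟_ : DecidableEquality V) {m : ℕ} (A : CliqueFamily V (suc m)) where

  open CliqueUnion _≟_ A
  open Greedy _≟_ adjacent? adjacent-sym m

  sortedByDegree⇒Degenerate : maxShared * maxShared ≤ suc m →
    ∀ {L} → Unique L → AllPairs (λ u w → degree u ≤ degree w) L → Degenerate L
  sortedByDegree⇒Degenerate max² [] [] = []
  sortedByDegree⇒Degenerate max² {v ∷ rest} (v∉rest ∷ unique) (v≤rest ∷ sorted) =
    later-neighbours< distinct later (s≤s z≤n) max² ∷ sortedByDegree⇒Degenerate max² unique sorted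
    where
    distinct : Unique (v ∷ filter (adjacent? v) rest)
    distinct = Allₚ.filter⁺ (adjacent? v) v∉rest ∷ AllPairsₚ.filter⁺ (adjacent? v) unique
    later : ∀ {u} → u ∈ filter (adjacent? v) rest → Adjacent v u × degree v ≤ degree u
    later u∈ with ∈-filter⁻ (adjacent? v) u∈
    ... | u∈rest , adj = adj , All.lookup v≤rest u∈rest

theorem1 : (n : ℕ) → 1 ≤ n → (V : Set) → (_≟_ : DecidableEquality V) →
    (A : CliqueFamily V n) → EachHasNVertices A → AtMostOneCommon A →
    ((i : Fin n) → sharedCount _≟_ A i * sharedCount _≟_ A i ≤ n) →
    ∃ λ (c : V → Fin n) → ProperColouring A c
theorem1 (suc m) _ V _≟_ A _ _ few-shared = greedy colouringOrder , proper
  where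
  open CliqueUnion _≟_ A
  open Greedy _≟_ adjacent? adjacent-sym m
  degenerate : Degenerate colouringOrder
  degenerate = sortedByDegree⇒Degenerate _≟_ A (maxShared²≤ few-shared) colouringOrder-unique colouringOrder-sorted
  proper : ProperColouring A (greedy colouringOrder)
  proper i u w u∈i w∈i = greedy-proper degenerate (∈-colouringOrder u∈i) (∈-colouringOrder w∈i) (i , u∈i , w∈i)
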